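{- Let $n>d>\ell\ge 1$ be integers and let $r$ be the integer with $0\le r\le \ell$ and $r\equiv d-\ell \pmod{\ell+1}$. Then $$ \left(2^{d-\ell}\binom{d}{\ell}\right)^{ -1}\;\le\; c_d^{(\ell)}\;\le\;\left\lceil \frac{d+1}{\ell+1}\right\rceil^{ -r}\left\lfloor \frac{d+1}{\ell+1}\right\rfloor^{ -(\ell+1-r)}. $$
   Context: $Q_n$ is the $n$-dimensional hypercube on $\{0,1\}^n$, edges joining vertices differing in exactly one coordinate. For $1\le i\le n-1$, a copy of $Q_i$ in $Q_n$ (subcube) is the subgraph induced by all vertices agreeing with a fixed $0/1$ assignment on a fixed set of $n-i$ coordinates; $\mathcal{H}_n^i$ is the set of these copies, so $|\mathcal{H}_n^i|=2^{n-i}\binom{n}{i}$. For $\ell<d$, a subset $S\subseteq\mathcal{H}_n^\ell$ is a $(d,\ell)$-covering set if every member of $\mathcal{H}_n^d$ contains (as a subcube) some member of $S$. $f^{(\ell)}(n,d)$ is the minimum size of a $(d,\ell)$-covering set, $c^{(\ell)}(n,d)=f^{(\ell)}(n,d)/\left(2^{n-\ell}\binom{n}{\ell}\right)$, which is non-decreasing in $n$, and $c_d^{(\ell)}=\lim_{n\to\infty}c^{(\ell)}(n,d)$. -}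

module Defs where

open import Data.Nat as ℕ using (ℕ; zero; suc; _∸_; _^_)
open import Data.Nat.DivMod using (_/_; _%_)
open import Data.Nat.Combinatorics using (_C_)
open import Data.Integer using (+_)
open import Data.Maybe using (Maybe; just; nothing)
open import Data.Bool using (Bool)
open import Data.Fin using (Fin)
open import Data.Vec using (Vec; lookup)
open import Data.List using (List; length)
open import Data.List.Relation.Unary.All using (All)
open import Data.List.Relation.Unary.Any using (Any)
open import Data.List.Relation.Unary.Unique.Propositional using (Unique)
open import Data.Sum using (_⊎_)
open import Data.Product using (_×_)
open import Data.Rational as ℚ using (ℚ; 0ℚ)
open import Relation.Binary.PropositionalEquality using (_≡_)

Vertex : ℕ → Set
Vertex n = Vec Bool n

-- A subcube of Q_n: for each coordinate either free (nothing) or fixed to a value.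
Subcube : ℕ → Set
Subcube n = Vec (Maybe Bool) n

dim : ∀ {n} → Subcube n → ℕ
dim Vec.[] = 0
dim (nothing Vec.∷ s) = suc (dim s)
dim (just _ Vec.∷ s) = dim s

_∈C_ : ∀ {n} → Vertex n → Subcube n → Set
_∈C_ {n} v A = (j : Fin n) → (lookup A j ≡ nothing) ⊎ (lookup A j ≡ just (lookup v j))

_⊑_ : ∀ {n} → Subcube n → Subcube n → Set
_⊑_ {n} A B = (v : Vertex n) → v ∈C A → v ∈C B

-- S (a finite set of copies of Q_ℓ, as a duplicate-free list) is a (d,ℓ)-covering set in Q_n
IsCovering : (n d ℓ : ℕ) → List (Subcube n) → Set
IsCovering n d ℓ S =
  Unique S × All (λ A → dim A ≡ ℓ) S ×
  ((B : Subcube n) → dim B ≡ d → Any (λ A → A ⊑ B) S)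

IsMinCover : (n d ℓ k : ℕ) → Set
IsMinCover n d ℓ k =
  (Data.Product.Σ (List (Subcube n)) λ S → IsCovering n d ℓ S × length S ≡ k) ×
  ((S : List (Subcube n)) → IsCovering n d ℓ S → k ℕ.≤ length S)

-- 1/m as a rational (only used for m > 0; value 0 at m = 0 is a junk convention)
recipℕ : ℕ → ℚ
recipℕ zero = 0ℚ
recipℕ (suc m) = (+ 1) ℚ./ suc m

numSubcubes : (n ℓ : ℕ) → ℕ
numSubcubes n ℓ = 2 ^ (n ∸ ℓ) ℕ.* (n C ℓ)

cRatio : (n ℓ k : ℕ) → ℚ
cRatio n ℓ k = ((+ k) ℚ./ 1) ℚ.* recipℕ (numSubcubes n ℓ)

lowerBound : (d ℓ : ℕ) → ℚ
lowerBound d ℓ = recipℕ (2 ^ (d ∸ ℓ) ℕ.* (d C ℓ))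

rOf : (d ℓ : ℕ) → ℕ
rOf d ℓ = (d ∸ ℓ) % suc ℓ

ceilQ : (d ℓ : ℕ) → ℕ
ceilQ d ℓ = (suc d ℕ.+ ℓ) / suc ℓ

floorQ : (d ℓ : ℕ) → ℕ
floorQ d ℓ = suc d / suc ℓ

upperBound : (d ℓ : ℕ) → ℚ
upperBound d ℓ = recipℕ (ceilQ d ℓ ^ rOf d ℓ ℕ.* floorQ d ℓ ^ (suc ℓ ∸ rOf d ℓ))

module Submission where

-- Lower bound: each ℓ-subcube lies in exactly C(n−ℓ, d−ℓ) of the 2^(n−d) C(n,d) d-subcubes, and a
-- covering set meets every d-subcube, so |S| C(n−ℓ, d−ℓ) ≥ 2^(n−d) C(n,d); by the identity
-- 2^(n−d) C(n,d) · 2^(d−ℓ) C(d,ℓ) = 2^(n−ℓ) C(n,ℓ) · C(n−ℓ, d−ℓ) this is the bound on |S| / |H_n^ℓ|.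
--
-- Upper bound: take radices a_0, …, a_ℓ ≥ 1 with a_0 + ⋯ + a_ℓ ≤ d + 1. The ℓ free coordinates of an
-- ℓ-subcube A cut its fixed coordinates into ℓ+1 segments; colour A by the number of ones in the i-th
-- segment modulo a_i, for all i. Inside a d-subcube B, choose the free coordinates of A among those of
-- B so that the i-th segment of A contains at least a_i − 1 free coordinates of B; setting those shifts
-- the weight of the segment by any amount below a_i, so every one of the a_0 ⋯ a_ℓ colours occurs
-- inside B. Each colour class is therefore a covering set, and the smallest has at most
-- |H_n^ℓ| / (a_0 ⋯ a_ℓ) elements. Taking r radices ⌈(d+1)/(ℓ+1)⌉ and ℓ+1−r radices ⌊(d+1)/(ℓ+1)⌋
-- gives the bound. Both bounds hold for every n ≥ d.

module CoveringBounds where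

  open import Defs
  open import Data.Bool as Bool using (Bool; true; false; not)
  open import Data.Bool.Properties using (not-¬)
  open import Data.Empty using (⊥-elim)
  open import Data.Fin using () renaming (zero to fzero; suc to fsuc)
  import Data.Integer as ℤ
  import Data.Integer.Properties as ℤ
  open import Data.List using (List; []; _∷_; _++_; map; filter; length; replicate; deduplicate; applyDownFrom)
  open import Data.List.Membership.Propositional using (_∈_)
  open import Data.List.Membership.Propositional.Properties
    using (∈-++⁺ˡ; ∈-++⁺ʳ; ∈-map⁺; ∈-filter⁺; ∈-filter⁻; ∈-deduplicate⁺; ∈-deduplicate⁻)
  open import Data.List.Properties
    using ( length-map; length-++; length-replicate; map-++; map-replicate; filter-++; filter-none; filter-some
          ; filter-all; filter-accept; filter-reject; length-deduplicate)
  open import Data.List.Relation.Unary.All as All using (All; []; _∷_)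
  import Data.List.Relation.Unary.All.Properties as All
  open import Data.List.Relation.Unary.Any as Any using (Any; here; there)
  open import Data.List.Relation.Unary.Unique.DecPropositional.Properties using (deduplicate-!)
  open import Data.Maybe using (Maybe; just; nothing; fromMaybe)
  open import Data.Maybe.Properties as Maybe using (just-injective)
  open import Data.Nat
    using (ℕ; zero; suc; _+_; _*_; _∸_; _^_; _≤_; _<_; _!; z≤n; s≤s; s≤s⁻¹; NonZero; >-nonZero; >-nonZero⁻¹)
  open import Data.Nat.Combinatorics using (_C_; nCk+nC[k+1]≡[n+1]C[k+1]; k>n⇒nCk≡0; nCk≡n!/k![n-k]!; k![n∸k]!∣n!)
  open import Data.Nat.Divisibility using (∣-refl)
  open import Data.Nat.DivMod
    using ( _%_; _/_; m%n<n; m%n%n≡m%n; %-distribˡ-+; [m+n]%n≡m%n; [m+kn]%n≡m%n; m<n⇒m%n≡m; m≡m%n+[m/n]*n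
          ; m<n*o⇒m/o<n; m/n*n≡m; m≥n⇒m/n>0; /-monoˡ-≤; +-distrib-/-∣ʳ; n/n≡1)
  open import Data.Nat.ListAction using (sum; product)
  open import Data.Nat.ListAction.Properties using (sum-++; product-++; product≢0)
  open import Data.Nat.Properties
  open import Algebra.Properties.CommutativeSemigroup +-commutativeSemigroup using (x∙yz≈y∙xz)
  open import Data.Nat.Tactic.RingSolver using (solve-∀)
  open import Data.Product using (_×_; _,_; proj₁; ∃; ∃-syntax)
  import Data.Rational as ℚ
  import Data.Rational.Properties as ℚ
  import Data.Rational.Unnormalised as ℚᵘ
  import Data.Rational.Unnormalised.Properties as ℚᵘ
  open import Data.Sum using (_⊎_; inj₁; inj₂)
  open import Data.Vec as Vec using (Vec; []; _∷_)
  open import Data.Vec.Properties as Vec using ()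
  open import Data.Vec.Relation.Binary.Pointwise.Inductive as Pointwise using (Pointwise; []; _∷_)
  open import Function using (_∘_; _∘′_)
  open import Relation.Binary.Core using (REL)
  open import Relation.Binary.Definitions using (Decidable; DecidableEquality; tri<; tri≈; tri>)
  open import Relation.Binary.PropositionalEquality
  open import Relation.Nullary using (yes; no; ¬_)
  import Relation.Nullary.Decidable as Dec
  open import Relation.Unary as U using (Pred)

  -- Containment of subcubes

  data _≼_ : Maybe Bool → Maybe Bool → Set where
    free  : ∀ {a} → a ≼ nothing
    fixed : ∀ {b} → just b ≼ just b

  _≼?_ : Decidable _≼_
  a ≼? nothing = yes free
  nothing ≼? just b = no λ ()
  just a ≼? just b = Dec.map′ (λ { refl → fixed }) (λ { fixed → refl }) (a Bool.≟ b)

  _⊆ᶜ_ : ∀ {n} → Subcube n → Subcube n → Set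
  _⊆ᶜ_ = Pointwise _≼_

  _⊆ᶜ?_ : ∀ {n} → Decidable (_⊆ᶜ_ {n})
  _⊆ᶜ?_ = Pointwise.decidable _≼?_

  ∈C-∷ : ∀ {n x a} {v : Vertex n} {A : Subcube n} →
         (a ≡ nothing ⊎ a ≡ just x) → v ∈C A → (x ∷ v) ∈C (a ∷ A)
  ∈C-∷ x∈a _   fzero    = x∈a
  ∈C-∷ _   v∈A (fsuc j) = v∈A j

  fromMaybe-∈ : ∀ x (a : Maybe Bool) → a ≡ nothing ⊎ a ≡ just (fromMaybe x a)
  fromMaybe-∈ x nothing  = inj₁ refl
  fromMaybe-∈ x (just b) = inj₂ refl

  pointOf : ∀ {n} → Subcube n → Vertex n
  pointOf = Vec.map (fromMaybe false)

  pointOf-∈ : ∀ {n} (A : Subcube n) → pointOf A ∈C A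
  pointOf-∈ []      ()
  pointOf-∈ (a ∷ A) = ∈C-∷ (fromMaybe-∈ false a) (pointOf-∈ A)

  ⊆ᶜ⇒⊑ : ∀ {n} {A B : Subcube n} → A ⊆ᶜ B → A ⊑ B
  ⊆ᶜ⇒⊑ (free  ∷ _)   _       _   fzero    = inj₁ refl
  ⊆ᶜ⇒⊑ (fixed ∷ _)   _       v∈A fzero    = v∈A fzero
  ⊆ᶜ⇒⊑ (_     ∷ A⊆B) (_ ∷ v) v∈A (fsuc j) = ⊆ᶜ⇒⊑ A⊆B v (λ i → v∈A (fsuc i)) j

  ⊑-head : ∀ {n} a b {A B : Subcube n} → (a ∷ A) ⊑ (b ∷ B) → a ≼ b
  ⊑-head a nothing _ = free
  ⊑-head nothing (just y) {A} a⊑b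
    with a⊑b (not y ∷ pointOf A) (∈C-∷ (inj₁ refl) (pointOf-∈ A)) fzero
  ... | inj₂ y≡not-y = ⊥-elim (not-¬ refl (just-injective y≡not-y))
  ⊑-head (just x) (just y) {A} a⊑b
    with a⊑b (x ∷ pointOf A) (∈C-∷ (inj₂ refl) (pointOf-∈ A)) fzero
  ... | inj₂ refl = fixed

  ⊑⇒⊆ᶜ : ∀ {n} {A B : Subcube n} → A ⊑ B → A ⊆ᶜ B
  ⊑⇒⊆ᶜ {A = []}    {[]}    _   = []
  ⊑⇒⊆ᶜ {A = a ∷ A} {b ∷ B} A⊑B = ⊑-head a b A⊑B ∷ ⊑⇒⊆ᶜ tail⊑
    where
    tail⊑ : A ⊑ B
    tail⊑ v v∈A j = A⊑B (fromMaybe false a ∷ v) (∈C-∷ (fromMaybe-∈ false a) v∈A) (fsuc j)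

  ⊆ᶜ⇒dim≤ : ∀ {n} {A B : Subcube n} → A ⊆ᶜ B → dim A ≤ dim B
  ⊆ᶜ⇒dim≤ []                          = z≤n
  ⊆ᶜ⇒dim≤ {A = nothing ∷ _} (free ∷ A⊆B) = s≤s (⊆ᶜ⇒dim≤ A⊆B)
  ⊆ᶜ⇒dim≤ {A = just _ ∷ _}  (free ∷ A⊆B) = m≤n⇒m≤1+n (⊆ᶜ⇒dim≤ A⊆B)
  ⊆ᶜ⇒dim≤ (fixed ∷ A⊆B)               = ⊆ᶜ⇒dim≤ A⊆B

  codim : ∀ {n} → Subcube n → ℕ
  codim []             = 0
  codim (nothing ∷ A)  = codim A
  codim (just _ ∷ A)   = suc (codim A)

  codim+dim≡n : ∀ {n} (A : Subcube n) → codim A + dim A ≡ n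
  codim+dim≡n []            = refl
  codim+dim≡n (nothing ∷ A) = trans (+-suc (codim A) (dim A)) (cong suc (codim+dim≡n A))
  codim+dim≡n (just _ ∷ A)  = cong suc (codim+dim≡n A)

  -- Enumerating subcubes and counting supercubes

  withFixedHead : ∀ {n} → List (Subcube n) → List (Subcube (suc n))
  withFixedHead L = map (just true ∷_) L ++ map (just false ∷_) L

  subcubes : (n k : ℕ) → List (Subcube n)
  subcubes zero    zero    = [] ∷ []
  subcubes zero    (suc k) = []
  subcubes (suc n) zero    = withFixedHead (subcubes n zero)
  subcubes (suc n) (suc k) = map (nothing ∷_) (subcubes n k) ++ withFixedHead (subcubes n (suc k))

  length-withFixedHead : ∀ {n} (L : List (Subcube n)) → length (withFixedHead L) ≡ 2 * length L
  length-withFixedHead L = begin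
    length (map (just true ∷_) L ++ map (just false ∷_) L)    ≡⟨ length-++ (map (just true ∷_) L) ⟩
    length (map (just true ∷_) L) + length (map (just false ∷_) L)
      ≡⟨ cong₂ _+_ (length-map _ L) (trans (length-map _ L) (sym (+-identityʳ _))) ⟩
    2 * length L                                              ∎
    where open ≡-Reasoning

  2*2^[n∸1+k]*nC[1+k]≡2^[n∸k]*nC[1+k] : ∀ n k → 2 * (2 ^ (n ∸ suc k) * (n C suc k)) ≡ 2 ^ (n ∸ k) * (n C suc k)
  2*2^[n∸1+k]*nC[1+k]≡2^[n∸k]*nC[1+k] n k with k <? n
  ... | yes k<n = begin
    2 * (2 ^ (n ∸ suc k) * (n C suc k))  ≡⟨ *-assoc 2 (2 ^ (n ∸ suc k)) (n C suc k) ⟨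
    2 ^ suc (n ∸ suc k) * (n C suc k)    ≡⟨ cong (λ e → 2 ^ e * (n C suc k)) (sym (+-∸-assoc 1 k<n)) ⟩
    2 ^ (n ∸ k) * (n C suc k)            ∎
    where open ≡-Reasoning
  ... | no k≮n rewrite k>n⇒nCk≡0 (s≤s (≮⇒≥ k≮n)) | *-zeroʳ (2 ^ (n ∸ suc k)) | *-zeroʳ (2 ^ (n ∸ k)) = refl

  length-subcubes : ∀ n k → length (subcubes n k) ≡ 2 ^ (n ∸ k) * (n C k)
  length-subcubes zero    zero    = refl
  length-subcubes zero    (suc k) = refl
  length-subcubes (suc n) zero    = begin
    length (withFixedHead (subcubes n zero))  ≡⟨ length-withFixedHead (subcubes n zero) ⟩
    2 * length (subcubes n zero)              ≡⟨ cong (2 *_) (length-subcubes n zero) ⟩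
    2 * (2 ^ n * 1)                           ≡⟨ *-assoc 2 (2 ^ n) 1 ⟨
    2 ^ suc n * 1                             ∎
    where open ≡-Reasoning
  length-subcubes (suc n) (suc k) = begin
    length (map (nothing ∷_) (subcubes n k) ++ withFixedHead (subcubes n (suc k)))
      ≡⟨ length-++ (map (nothing ∷_) (subcubes n k)) ⟩
    length (map (nothing ∷_) (subcubes n k)) + length (withFixedHead (subcubes n (suc k)))
      ≡⟨ cong₂ _+_ (trans (length-map _ (subcubes n k)) (length-subcubes n k))
                   (trans (length-withFixedHead (subcubes n (suc k))) (cong (2 *_) (length-subcubes n (suc k)))) ⟩
    2 ^ (n ∸ k) * (n C k) + 2 * (2 ^ (n ∸ suc k) * (n C suc k))
      ≡⟨ cong (2 ^ (n ∸ k) * (n C k) +_) (2*2^[n∸1+k]*nC[1+k]≡2^[n∸k]*nC[1+k] n k) ⟩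
    2 ^ (n ∸ k) * (n C k) + 2 ^ (n ∸ k) * (n C suc k)
      ≡⟨ *-distribˡ-+ (2 ^ (n ∸ k)) (n C k) (n C suc k) ⟨
    2 ^ (n ∸ k) * (n C k + n C suc k)
      ≡⟨ cong (2 ^ (n ∸ k) *_) (nCk+nC[k+1]≡[n+1]C[k+1] n k) ⟩
    2 ^ (n ∸ k) * (suc n C suc k)
      ∎
    where open ≡-Reasoning

  subcubes-dim : ∀ n k → All (λ A → dim A ≡ k) (subcubes n k)
  subcubes-dim zero    zero    = refl ∷ []
  subcubes-dim zero    (suc k) = []
  subcubes-dim (suc n) zero    = withFixedHead-dim (subcubes-dim n zero)
    where
    withFixedHead-dim : ∀ {L} → All (λ A → dim A ≡ 0) L → All (λ A → dim A ≡ 0) (withFixedHead L)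
    withFixedHead-dim all = All.++⁺ (All.map⁺ all) (All.map⁺ all)
  subcubes-dim (suc n) (suc k) =
    All.++⁺ (All.map⁺ (All.map (cong suc) (subcubes-dim n k)))
            (All.++⁺ (All.map⁺ (subcubes-dim n (suc k))) (All.map⁺ (subcubes-dim n (suc k))))

  ∈-withFixedHead : ∀ {n} b {A : Subcube n} {L} → A ∈ L → (just b ∷ A) ∈ withFixedHead L
  ∈-withFixedHead true          A∈L = ∈-++⁺ˡ (∈-map⁺ _ A∈L)
  ∈-withFixedHead false {L = L} A∈L = ∈-++⁺ʳ (map (just true ∷_) L) (∈-map⁺ _ A∈L)

  ∈-subcubes : ∀ {n} (A : Subcube n) → A ∈ subcubes n (dim A)
  ∈-subcubes []            = here refl
  ∈-subcubes (nothing ∷ A) = ∈-++⁺ˡ (∈-map⁺ _ (∈-subcubes A))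
  ∈-subcubes {suc n} (just b ∷ A) with dim A | ∈-subcubes A
  ... | zero  | A∈ = ∈-withFixedHead b A∈
  ... | suc k | A∈ = ∈-++⁺ʳ (map (nothing ∷_) (subcubes n k)) (∈-withFixedHead b A∈)

  module _ {a b p q} {A : Set a} {B : Set b} {P : Pred B p} {Q : Pred A q}
           (P? : U.Decidable P) (Q? : U.Decidable Q) (f : A → B) where

    length-filter-map : (∀ x → P (f x) → Q x) → (∀ x → Q x → P (f x)) →
                        ∀ xs → length (filter P? (map f xs)) ≡ length (filter Q? xs)
    length-filter-map to from [] = refl
    length-filter-map to from (x ∷ xs) with P? (f x) | Q? x
    ... | yes _  | yes _ = cong suc (length-filter-map to from xs)
    ... | no _   | no _  = length-filter-map to from xs
    ... | yes px | no ¬q = ⊥-elim (¬q (to x px))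
    ... | no ¬px | yes q = ⊥-elim (¬px (from x q))

  length-filter-map-none : ∀ {a b p} {A : Set a} {B : Set b} {P : Pred B p} (P? : U.Decidable P) (f : A → B) →
                           (∀ x → ¬ P (f x)) → ∀ xs → length (filter P? (map f xs)) ≡ 0
  length-filter-map-none P? f ¬P xs = cong length (filter-none P? (All.map⁺ (All.universal ¬P xs)))

  #supercubesIn : ∀ {n} → Subcube n → List (Subcube n) → ℕ
  #supercubesIn A L = length (filter (A ⊆ᶜ?_) L)

  #supercubes : ∀ {n} → Subcube n → ℕ → ℕ
  #supercubes {n} A k = #supercubesIn A (subcubes n k)

  #supercubesIn-++ : ∀ {n} (A : Subcube n) L L′ →
                     #supercubesIn A (L ++ L′) ≡ #supercubesIn A L + #supercubesIn A L′
  #supercubesIn-++ A L L′ = trans (cong length (filter-++ (A ⊆ᶜ?_) L L′)) (length-++ (filter (A ⊆ᶜ?_) L))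

  module _ {n} (A : Subcube n) where

    #supercubesIn-map : ∀ {a c} → a ≼ c → ∀ L → #supercubesIn (a ∷ A) (map (c ∷_) L) ≡ #supercubesIn A L
    #supercubesIn-map {a} {c} a≼c =
      length-filter-map ((a ∷ A) ⊆ᶜ?_) (A ⊆ᶜ?_) (c ∷_) (λ _ → Pointwise.tail) (λ _ → a≼c ∷_)

    #supercubesIn-map-none : ∀ {a c} → ¬ a ≼ c → ∀ L → #supercubesIn (a ∷ A) (map (c ∷_) L) ≡ 0
    #supercubesIn-map-none {a} {c} a⋠c =
      length-filter-map-none ((a ∷ A) ⊆ᶜ?_) (c ∷_) (λ _ → a⋠c ∘ Pointwise.head)

    #supercubesIn-withFixedHead-free : ∀ L → #supercubesIn (nothing ∷ A) (withFixedHead L) ≡ 0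
    #supercubesIn-withFixedHead-free L = trans (#supercubesIn-++ (nothing ∷ A) (map (just true ∷_) L) _)
      (cong₂ _+_ (#supercubesIn-map-none (λ ()) L) (#supercubesIn-map-none (λ ()) L))

    #supercubesIn-withFixedHead-fixed : ∀ b L → #supercubesIn (just b ∷ A) (withFixedHead L) ≡ #supercubesIn A L
    #supercubesIn-withFixedHead-fixed true L = trans (#supercubesIn-++ (just true ∷ A) (map (just true ∷_) L) _)
      (trans (cong₂ _+_ (#supercubesIn-map fixed L) (#supercubesIn-map-none (λ ()) L)) (+-identityʳ _))
    #supercubesIn-withFixedHead-fixed false L = trans (#supercubesIn-++ (just false ∷ A) (map (just true ∷_) L) _)
      (cong₂ _+_ (#supercubesIn-map-none (λ ()) L) (#supercubesIn-map fixed L))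

    #supercubes-free : ∀ k → #supercubes (nothing ∷ A) (suc k) ≡ #supercubes A k
    #supercubes-free k = begin
      #supercubesIn (nothing ∷ A) (map (nothing ∷_) (subcubes n k) ++ withFixedHead (subcubes n (suc k)))
        ≡⟨ #supercubesIn-++ (nothing ∷ A) (map (nothing ∷_) (subcubes n k)) _ ⟩
      #supercubesIn (nothing ∷ A) (map (nothing ∷_) (subcubes n k))
        + #supercubesIn (nothing ∷ A) (withFixedHead (subcubes n (suc k)))
        ≡⟨ cong₂ _+_ (#supercubesIn-map free (subcubes n k))
                     (#supercubesIn-withFixedHead-free (subcubes n (suc k))) ⟩
      #supercubes A k + 0
        ≡⟨ +-identityʳ _ ⟩
      #supercubes A k
        ∎
      where open ≡-Reasoning

    #supercubes-fixed-zero : ∀ b → #supercubes (just b ∷ A) zero ≡ #supercubes A zero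
    #supercubes-fixed-zero b = #supercubesIn-withFixedHead-fixed b (subcubes n zero)

    #supercubes-fixed-suc : ∀ b k → #supercubes (just b ∷ A) (suc k) ≡ #supercubes A k + #supercubes A (suc k)
    #supercubes-fixed-suc b k =
      trans (#supercubesIn-++ (just b ∷ A) (map (nothing ∷_) (subcubes n k)) (withFixedHead (subcubes n (suc k))))
            (cong₂ _+_ (#supercubesIn-map free (subcubes n k))
                       (#supercubesIn-withFixedHead-fixed b (subcubes n (suc k))))

    #supercubes-below : ∀ k → k < dim A → #supercubes A k ≡ 0
    #supercubes-below k k<dim = cong length (filter-none (A ⊆ᶜ?_) (All.map ¬⊆ᶜ (subcubes-dim n k)))
      where
      ¬⊆ᶜ : ∀ {B} → dim B ≡ k → ¬ A ⊆ᶜ B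
      ¬⊆ᶜ refl A⊆B = <⇒≱ k<dim (⊆ᶜ⇒dim≤ A⊆B)

  #supercubes≡C : ∀ {n} (A : Subcube n) k → dim A ≤ k → #supercubes A k ≡ codim A C (k ∸ dim A)
  #supercubes≡C []            zero    _ = refl
  #supercubes≡C []            (suc k) _ = refl
  #supercubes≡C (nothing ∷ A) (suc k) (s≤s dim≤k) =
    trans (#supercubes-free A k) (#supercubes≡C A k dim≤k)
  #supercubes≡C (just b ∷ A)  zero    dim≤0 = begin
    #supercubes (just b ∷ A) 0         ≡⟨ #supercubes-fixed-zero A b ⟩
    #supercubes A 0                    ≡⟨ #supercubes≡C A 0 dim≤0 ⟩
    codim A C (0 ∸ dim A)              ≡⟨ cong (codim A C_) (0∸n≡0 (dim A)) ⟩
    suc (codim A) C 0                  ≡⟨ cong (suc (codim A) C_) (0∸n≡0 (dim A)) ⟨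
    suc (codim A) C (0 ∸ dim A)        ∎
    where open ≡-Reasoning
  #supercubes≡C (just b ∷ A)  (suc k) dim≤1+k with m≤n⇒m<n∨m≡n dim≤1+k
  ... | inj₁ (s≤s dim≤k) = begin
    #supercubes (just b ∷ A) (suc k)                       ≡⟨ #supercubes-fixed-suc A b k ⟩
    #supercubes A k + #supercubes A (suc k)                ≡⟨ cong₂ _+_ (#supercubes≡C A k dim≤k)
                                                                        (#supercubes≡C A (suc k) dim≤1+k) ⟩
    codim A C (k ∸ dim A) + codim A C (suc k ∸ dim A)      ≡⟨ cong (λ e → codim A C (k ∸ dim A) + codim A C e)
                                                                   1+k∸dim ⟩
    codim A C (k ∸ dim A) + codim A C suc (k ∸ dim A)      ≡⟨ nCk+nC[k+1]≡[n+1]C[k+1] (codim A) (k ∸ dim A) ⟩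
    suc (codim A) C suc (k ∸ dim A)                        ≡⟨ cong (suc (codim A) C_) 1+k∸dim ⟨
    suc (codim A) C (suc k ∸ dim A)                        ∎
    where
    open ≡-Reasoning
    1+k∸dim : suc k ∸ dim A ≡ suc (k ∸ dim A)
    1+k∸dim = +-∸-assoc 1 dim≤k
  ... | inj₂ dim≡1+k = begin
    #supercubes (just b ∷ A) (suc k)                       ≡⟨ #supercubes-fixed-suc A b k ⟩
    #supercubes A k + #supercubes A (suc k)                ≡⟨ cong₂ _+_ (#supercubes-below A k (≤-reflexive (sym dim≡1+k)))
                                                                        (#supercubes≡C A (suc k) dim≤1+k) ⟩
    codim A C (suc k ∸ dim A)                              ≡⟨ cong (codim A C_) 1+k∸dim ⟩
    suc (codim A) C 0                                      ≡⟨ cong (suc (codim A) C_) 1+k∸dim ⟨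
    suc (codim A) C (suc k ∸ dim A)                        ∎
    where
    open ≡-Reasoning
    1+k∸dim : suc k ∸ dim A ≡ 0
    1+k∸dim = trans (cong (suc k ∸_) dim≡1+k) (n∸n≡0 (suc k))

  -- The lower bound: double counting

  C-positive : ∀ {n k} → k ≤ n → 0 < (n C k)
  C-positive {n}     {zero}  _         = s≤s z≤n
  C-positive {suc n} {suc k} (s≤s k≤n) =
    subst (0 <_) (nCk+nC[k+1]≡[n+1]C[k+1] n k) (≤-trans (C-positive k≤n) (m≤m+n (n C k) (n C suc k)))

  nCk*[k!*[n∸k]!]≡n! : ∀ {n k} → k ≤ n → (n C k) * (k ! * (n ∸ k) !) ≡ n !
  nCk*[k!*[n∸k]!]≡n! {n} {k} k≤n = trans (cong (_* (k ! * (n ∸ k) !)) (nCk≡n!/k![n-k]! k≤n))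
                                     (m/n*n≡m {{k !* (n ∸ k) !≢0}} (k![n∸k]!∣n! k≤n))

  -- Both sides times l! (d ∸ l)! (n ∸ d)! are n!.
  nCd*dCl≡nCl*[n∸l]C[d∸l] : ∀ {n d l} → l ≤ d → d ≤ n → (n C d) * (d C l) ≡ (n C l) * ((n ∸ l) C (d ∸ l))
  nCd*dCl≡nCl*[n∸l]C[d∸l] {n} {d} {l} l≤d d≤n =
    *-cancelʳ-≡ _ _ (l ! * (d ∸ l) ! * (n ∸ d) !) {{nonZero}} (trans lhs (sym rhs))
    where
    nonZero : NonZero (l ! * (d ∸ l) ! * (n ∸ d) !)
    nonZero = m*n≢0 (l ! * (d ∸ l) !) ((n ∸ d) !) {{l !* (d ∸ l) !≢0}} {{(n ∸ d) !≢0}}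
    n∸l∸[d∸l]≡n∸d : n ∸ l ∸ (d ∸ l) ≡ n ∸ d
    n∸l∸[d∸l]≡n∸d = trans (∸-+-assoc n l (d ∸ l)) (cong (n ∸_) (m+[n∸m]≡n l≤d))
    lhs : (n C d) * (d C l) * (l ! * (d ∸ l) ! * (n ∸ d) !) ≡ n !
    lhs = begin
      (n C d) * (d C l) * (l ! * (d ∸ l) ! * (n ∸ d) !)  ≡⟨ regroup (n C d) (d C l) (l !) ((d ∸ l) !) ((n ∸ d) !) ⟩
      (n C d) * ((d C l) * (l ! * (d ∸ l) !)) * (n ∸ d) ! ≡⟨ cong (λ x → (n C d) * x * (n ∸ d) !)
                                                                  (nCk*[k!*[n∸k]!]≡n! l≤d) ⟩
      (n C d) * d ! * (n ∸ d) !                          ≡⟨ *-assoc (n C d) (d !) ((n ∸ d) !) ⟩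
      (n C d) * (d ! * (n ∸ d) !)                        ≡⟨ nCk*[k!*[n∸k]!]≡n! d≤n ⟩
      n !                                              ∎
      where
      open ≡-Reasoning
      regroup : ∀ a b x y z → a * b * (x * y * z) ≡ a * (b * (x * y)) * z
      regroup = solve-∀
    rhs : (n C l) * ((n ∸ l) C (d ∸ l)) * (l ! * (d ∸ l) ! * (n ∸ d) !) ≡ n !
    rhs = begin
      (n C l) * ((n ∸ l) C (d ∸ l)) * (l ! * (d ∸ l) ! * (n ∸ d) !)
        ≡⟨ regroup (n C l) ((n ∸ l) C (d ∸ l)) (l !) ((d ∸ l) !) ((n ∸ d) !) ⟩
      (n C l) * (l ! * (((n ∸ l) C (d ∸ l)) * ((d ∸ l) ! * (n ∸ d) !)))
        ≡⟨ cong (λ m → (n C l) * (l ! * (((n ∸ l) C (d ∸ l)) * ((d ∸ l) ! * m !)))) n∸l∸[d∸l]≡n∸d ⟨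
      (n C l) * (l ! * (((n ∸ l) C (d ∸ l)) * ((d ∸ l) ! * (n ∸ l ∸ (d ∸ l)) !)))
        ≡⟨ cong (λ x → (n C l) * (l ! * x)) (nCk*[k!*[n∸k]!]≡n! (∸-monoˡ-≤ l d≤n)) ⟩
      (n C l) * (l ! * (n ∸ l) !)
        ≡⟨ nCk*[k!*[n∸k]!]≡n! (≤-trans l≤d d≤n) ⟩
      n !                                              ∎
      where
      open ≡-Reasoning
      regroup : ∀ a b x y z → a * b * (x * y * z) ≡ a * (x * (b * (y * z)))
      regroup = solve-∀

  numSubcubes-double-count : ∀ {n d ℓ} → ℓ ≤ d → d ≤ n →
                      numSubcubes n d * numSubcubes d ℓ ≡ numSubcubes n ℓ * ((n ∸ ℓ) C (d ∸ ℓ))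
  numSubcubes-double-count {n} {d} {ℓ} ℓ≤d d≤n = begin
    2 ^ (n ∸ d) * (n C d) * (2 ^ (d ∸ ℓ) * (d C ℓ))     ≡⟨ regroup (2 ^ (n ∸ d)) (n C d) (2 ^ (d ∸ ℓ)) (d C ℓ) ⟩
    2 ^ (n ∸ d) * 2 ^ (d ∸ ℓ) * ((n C d) * (d C ℓ))     ≡⟨ cong₂ _*_ 2^-split (nCd*dCl≡nCl*[n∸l]C[d∸l] ℓ≤d d≤n) ⟩
    2 ^ (n ∸ ℓ) * ((n C ℓ) * ((n ∸ ℓ) C (d ∸ ℓ)))       ≡⟨ *-assoc (2 ^ (n ∸ ℓ)) (n C ℓ) _ ⟨
    2 ^ (n ∸ ℓ) * (n C ℓ) * ((n ∸ ℓ) C (d ∸ ℓ))         ∎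
    where
    open ≡-Reasoning
    regroup : ∀ a b c e → a * b * (c * e) ≡ a * c * (b * e)
    regroup = solve-∀
    2^-split : 2 ^ (n ∸ d) * 2 ^ (d ∸ ℓ) ≡ 2 ^ (n ∸ ℓ)
    2^-split = trans (sym (^-distribˡ-+-* 2 (n ∸ d) (d ∸ ℓ)))
                     (cong (2 ^_) (trans (sym (+-∸-assoc (n ∸ d) ℓ≤d)) (cong (_∸ ℓ) (m∸n+n≡m d≤n))))

  module _ {a b r} {A : Set a} {B : Set b} {R : REL A B r} (R? : Decidable R) where

    private
      #related : List A → B → ℕ
      #related S y = length (filter (λ x → R? x y) S)

    sum-counts-∷ : ∀ y L S → sum (map (λ x → length (filter (R? x) (y ∷ L))) S)
                            ≡ #related S y + sum (map (λ x → length (filter (R? x) L)) S)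
    sum-counts-∷ y L []      = refl
    sum-counts-∷ y L (x ∷ S) with R? x y
    ... | yes _ = cong suc (trans (cong (#x +_) (sum-counts-∷ y L S)) (x∙yz≈y∙xz #x (#related S y) _))
      where #x = length (filter (R? x) L)
    ... | no _  = trans (cong (#x +_) (sum-counts-∷ y L S)) (x∙yz≈y∙xz #x (#related S y) _)
      where #x = length (filter (R? x) L)

    length≤sum-counts : ∀ S L → (∀ {y} → y ∈ L → Any (λ x → R x y) S) →
                        length L ≤ sum (map (λ x → length (filter (R? x) L)) S)
    length≤sum-counts S []      _       = z≤n
    length≤sum-counts S (y ∷ L) covered = subst (suc (length L) ≤_) (sym (sum-counts-∷ y L S))
      (+-mono-≤ (filter-some (λ x → R? x y) (covered (here refl)))
                (length≤sum-counts S L (covered ∘ there)))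

  sum-map-const : ∀ {a} {A : Set a} (f : A → ℕ) {c} {S} → All (λ x → f x ≡ c) S → sum (map f S) ≡ length S * c
  sum-map-const f []       = refl
  sum-map-const f (e ∷ es) = cong₂ _+_ e (sum-map-const f es)

  codim≡n∸dim : ∀ {n} (A : Subcube n) → codim A ≡ n ∸ dim A
  codim≡n∸dim A = trans (sym (m+n∸n≡m (codim A) (dim A))) (cong (_∸ dim A) (codim+dim≡n A))

  covering-lower-bound : ∀ {n d ℓ S} → ℓ ≤ d → d ≤ n → IsCovering n d ℓ S →
                         numSubcubes n ℓ ≤ length S * numSubcubes d ℓ
  covering-lower-bound {n} {d} {ℓ} {S} ℓ≤d d≤n (_ , dims , covers) =
    *-cancelʳ-≤ _ _ X {{>-nonZero (C-positive (∸-monoˡ-≤ ℓ d≤n))}} (begin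
      numSubcubes n ℓ * X                 ≡⟨ numSubcubes-double-count ℓ≤d d≤n ⟨
      numSubcubes n d * numSubcubes d ℓ   ≤⟨ *-monoˡ-≤ (numSubcubes d ℓ) #d-subcubes≤ ⟩
      length S * X * numSubcubes d ℓ      ≡⟨ *-assoc (length S) X _ ⟩
      length S * (X * numSubcubes d ℓ)    ≡⟨ cong (length S *_) (*-comm X _) ⟩
      length S * (numSubcubes d ℓ * X)    ≡⟨ *-assoc (length S) _ X ⟨
      length S * numSubcubes d ℓ * X      ∎)
    where
    open ≤-Reasoning
    X = (n ∸ ℓ) C (d ∸ ℓ)
    #supercubes≡X : All (λ A → #supercubes A d ≡ X) S
    #supercubes≡X = All.map (λ {A} dim≡ℓ →
      trans (#supercubes≡C A d (subst (_≤ d) (sym dim≡ℓ) ℓ≤d))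
            (cong₂ _C_ (trans (codim≡n∸dim A) (cong (n ∸_) dim≡ℓ)) (cong (d ∸_) dim≡ℓ))) dims
    covered : ∀ {B} → B ∈ subcubes n d → Any (_⊆ᶜ B) S
    covered {B} B∈ = Any.map ⊑⇒⊆ᶜ (covers B (All.lookup (subcubes-dim n d) B∈))
    #d-subcubes≤ : numSubcubes n d ≤ length S * X
    #d-subcubes≤ = begin
      numSubcubes n d                              ≡⟨ length-subcubes n d ⟨
      length (subcubes n d)                        ≤⟨ length≤sum-counts _⊆ᶜ?_ S (subcubes n d) covered ⟩
      sum (map (λ A → #supercubes A d) S)          ≡⟨ sum-map-const (λ A → #supercubes A d) #supercubes≡X ⟩
      length S * X                                 ∎

  -- The upper bound: a colouring of the ℓ-subcubes

  bit : Bool → ℕ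
  bit false = 0
  bit true  = 1

  -- The free coordinates of A cut its fixed coordinates into segments; the number of ones in the i-th
  -- segment modulo the i-th radix (suc p, then suc q for q ∈ ps) is the i-th digit of a mixed-radix
  -- number, w being the weight of the current segment read so far. (The value 0 for an A with more
  -- free coordinates than radices is never used.)
  colourFrom : ∀ {n} → ℕ → List ℕ → ℕ → Subcube n → ℕ
  colourFrom p ps       w []            = w % suc p
  colourFrom p ps       w (just b ∷ A)  = colourFrom p ps (bit b + w) A
  colourFrom p []       w (nothing ∷ A) = 0
  colourFrom p (q ∷ ps) w (nothing ∷ A) = w % suc p + suc p * colourFrom q ps 0 A

  #colours : List ℕ → ℕ
  #colours ps = product (map suc ps)

  #colours-nonZero : ∀ ps → NonZero (#colours ps)
  #colours-nonZero ps = product≢0 (All.map⁺ (All.universal (λ _ → _) ps))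

  colourFrom-< : ∀ {n} p ps w (A : Subcube n) → colourFrom p ps w A < #colours (p ∷ ps)
  colourFrom-< p ps w [] = <-≤-trans (m%n<n w (suc p)) (m≤m*n (suc p) (#colours ps) {{#colours-nonZero ps}})
  colourFrom-< p ps w (just b ∷ A) = colourFrom-< p ps (bit b + w) A
  colourFrom-< p [] w (nothing ∷ A) = s≤s z≤n
  colourFrom-< p (q ∷ ps) w (nothing ∷ A) = begin-strict
    w % suc p + suc p * colourFrom q ps 0 A  <⟨ +-monoˡ-< _ (m%n<n w (suc p)) ⟩
    suc p + suc p * colourFrom q ps 0 A      ≡⟨ cong (_+ suc p * colourFrom q ps 0 A) (*-identityʳ (suc p)) ⟨
    suc p * 1 + suc p * colourFrom q ps 0 A  ≡⟨ *-distribˡ-+ (suc p) 1 _ ⟨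
    suc p * suc (colourFrom q ps 0 A)        ≤⟨ *-monoʳ-≤ (suc p) (colourFrom-< q ps 0 A) ⟩
    suc p * #colours (q ∷ ps)                ∎
    where open ≤-Reasoning

  [m+n%d]%d≡[m+n]%d : ∀ m n d .{{_ : NonZero d}} → (m + n % d) % d ≡ (m + n) % d
  [m+n%d]%d≡[m+n]%d m n d = begin
    (m + n % d) % d              ≡⟨ %-distribˡ-+ m (n % d) d ⟩
    (m % d + n % d % d) % d      ≡⟨ cong (λ x → (m % d + x) % d) (m%n%n≡m%n n d) ⟩
    (m % d + n % d) % d          ≡⟨ %-distribˡ-+ m n d ⟨
    (m + n) % d                  ∎
    where open ≡-Reasoning

  -- e = (r + M F) mod (M+1) works because F + M F = (M+1) F.
  shift-to-residue : ∀ M F r → r < suc M → ∃[ e ] (e ≤ M × (F + e) % suc M ≡ r)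
  shift-to-residue M F r r<1+M = e , m<1+n⇒m≤n (m%n<n (r + M * F) (suc M)) , (begin
    (F + (r + M * F) % suc M) % suc M   ≡⟨ [m+n%d]%d≡[m+n]%d F (r + M * F) (suc M) ⟩
    (F + (r + M * F)) % suc M           ≡⟨ cong (_% suc M) (regroup F r M) ⟩
    (r + F * suc M) % suc M             ≡⟨ [m+kn]%n≡m%n r F (suc M) ⟩
    r % suc M                           ≡⟨ m<n⇒m%n≡m r<1+M ⟩
    r                                   ∎)
    where
    open ≡-Reasoning
    e = (r + M * F) % suc M
    regroup : ∀ F r M → F + (r + M * F) ≡ r + F * suc M
    regroup = solve-∀

  Attains : ∀ {n} → Subcube n → ℕ → List ℕ → ℕ → ℕ → Set
  Attains B p ps w x = ∃[ A ] (A ⊆ᶜ B × dim A ≡ length ps × colourFrom p ps w A ≡ x)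

  -- F is the weight that the fixed coordinates of B contribute to the current segment; the
  -- q free coordinates of B available to that segment shift its residue by any e ≤ q.
  WindowFrom : ∀ {n} → Subcube n → (q p : ℕ) → List ℕ → (c F : ℕ) → Set
  WindowFrom B q p ps c F = ∀ w e → e ≤ q → Attains B p ps w ((w + F + e) % suc p + suc p * c)

  Window : ∀ {n} → Subcube n → (q p : ℕ) → List ℕ → ℕ → Set
  Window B q p ps c = ∃ (WindowFrom B q p ps c)

  window⇒attains : ∀ {n} (B : Subcube n) p ps → (∀ c → c < #colours ps → Window B p p ps c) →
                     ∀ c → c < #colours (p ∷ ps) → Attains B p ps 0 c
  window⇒attains B p ps window c c<
    with window (c / suc p) (m<n*o⇒m/o<n (subst (c <_) (*-comm (suc p) (#colours ps)) c<))
  ... | F , realise with shift-to-residue p F (c % suc p) (m%n<n c (suc p))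
  ...   | e , e≤p , F+e≡c%p with realise 0 e e≤p
  ...     | A , A⊆B , dimA , colourA = A , A⊆B , dimA , (begin
    colourFrom p ps 0 A                         ≡⟨ colourA ⟩
    (F + e) % suc p + suc p * (c / suc p)       ≡⟨ cong₂ _+_ F+e≡c%p (*-comm (suc p) (c / suc p)) ⟩
    c % suc p + c / suc p * suc p               ≡⟨ m≡m%n+[m/n]*n c (suc p) ⟨
    c                                           ∎)
    where open ≡-Reasoning

  windows : ∀ {n} (B : Subcube n) q p ps → q + sum (map suc ps) ≤ dim B →
            ∀ c → c < #colours ps → Window B q p ps c
  windows [] zero p [] _ zero _ = 0 , λ { w zero _ → [] , [] , refl , sym (residue w) }
    where
    residue : ∀ w → (w + 0 + 0) % suc p + suc p * 0 ≡ w % suc p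
    residue w rewrite +-identityʳ (w + 0) | +-identityʳ w | *-zeroʳ (suc p) = +-identityʳ (w % suc p)
  windows [] zero p [] _ (suc c) (s≤s ())
  windows (just b ∷ B) q p ps h c c< with windows B q p ps h c c<
  ... | F , realise = bit b + F , realise′
    where
    realise′ : WindowFrom (just b ∷ B) q p ps c (bit b + F)
    realise′ w e e≤q with realise (bit b + w) e e≤q
    ... | A , A⊆B , dimA , colourA = just b ∷ A , fixed ∷ A⊆B , dimA ,
          trans colourA (cong (λ x → (x + e) % suc p + suc p * c) (regroup (bit b) w F))
      where
      regroup : ∀ x w F → x + w + F ≡ w + (x + F)
      regroup = solve-∀
  windows (nothing ∷ B) (suc q) p ps (s≤s h) c c< with windows B q p ps h c c<
  ... | F , realise = F , realise′
    where
    realise′ : WindowFrom (nothing ∷ B) (suc q) p ps c F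
    realise′ w zero _ with realise w zero z≤n
    ... | A , A⊆B , dimA , colourA = just false ∷ A , free ∷ A⊆B , dimA , colourA
    realise′ w (suc e) (s≤s e≤q) with realise (suc w) e e≤q
    ... | A , A⊆B , dimA , colourA = just true ∷ A , free ∷ A⊆B , dimA ,
          trans colourA (cong (λ x → x % suc p + suc p * c) (regroup w F e))
      where
      regroup : ∀ w F e → suc w + F + e ≡ w + F + suc e
      regroup = solve-∀
  windows (nothing ∷ B) zero p [] _ c c< with windows B zero p [] z≤n c c<
  ... | F , realise = F , λ { w zero _ → realise′ w }
    where
    realise′ : ∀ w → Attains (nothing ∷ B) p [] w ((w + F + 0) % suc p + suc p * c)
    realise′ w with realise w zero z≤n
    ... | A , A⊆B , dimA , colourA = just false ∷ A , free ∷ A⊆B , dimA , colourA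
  windows (nothing ∷ B) zero p (q ∷ ps) (s≤s h) c c<
    with window⇒attains B q ps (windows B q q ps h) c c<
  ... | A , A⊆B , dimA , colourA = 0 , λ { w zero _ → nothing ∷ A , free ∷ A⊆B , cong suc dimA , residue w }
    where
    residue : ∀ w → w % suc p + suc p * colourFrom q ps 0 A ≡ (w + 0 + 0) % suc p + suc p * c
    residue w rewrite +-identityʳ (w + 0) | +-identityʳ w = cong (λ x → w % suc p + suc p * x) colourA

  below-average : ∀ P .{{_ : NonZero P}} (f : ℕ → ℕ) → ∃[ c ] (c < P × P * f c ≤ sum (applyDownFrom f P))
  below-average (suc zero)    f = 0 , s≤s z≤n , ≤-refl
  below-average (suc (suc P)) f with below-average (suc P) f
  ... | c , c<1+P , avg with f c ≤? f (suc P)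
  ...   | yes fc≤ = c , m<n⇒m<1+n c<1+P , +-mono-≤ fc≤ avg
  ...   | no  fc≰ = suc P , ≤-refl , +-monoʳ-≤ (f (suc P)) (≤-trans (*-monoʳ-≤ (suc P) (<⇒≤ (≰⇒> fc≰))) avg)

  module _ {a} {X : Set a} (G : X → ℕ) where

    open ≡-Reasoning

    private
      inClass? : ∀ c → U.Decidable (λ x → G x ≡ c)
      inClass? c x = G x ≟ c
      below? : ∀ P → U.Decidable (λ x → G x < P)
      below? P x = G x <? P

    classSize : List X → ℕ → ℕ
    classSize L c = length (filter (inClass? c) L)

    length-filter-<-suc : ∀ P L → length (filter (below? (suc P)) L)
                                  ≡ classSize L P + length (filter (below? P) L)
    length-filter-<-suc P []      = refl
    length-filter-<-suc P (x ∷ L) with <-cmp (G x) P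
    ... | tri< Gx<P Gx≢P _ = begin
      length (filter (below? (suc P)) (x ∷ L))
        ≡⟨ cong length (filter-accept (below? (suc P)) (m<n⇒m<1+n Gx<P)) ⟩
      suc (length (filter (below? (suc P)) L))
        ≡⟨ cong suc (length-filter-<-suc P L) ⟩
      suc (classSize L P + length (filter (below? P) L))
        ≡⟨ +-suc (classSize L P) _ ⟨
      classSize L P + suc (length (filter (below? P) L))
        ≡⟨ cong₂ _+_ (cong length (filter-reject (inClass? P) Gx≢P))
                     (cong length (filter-accept (below? P) Gx<P)) ⟨
      classSize (x ∷ L) P + length (filter (below? P) (x ∷ L))
        ∎
    ... | tri≈ _ Gx≡P _ = begin
      length (filter (below? (suc P)) (x ∷ L))
        ≡⟨ cong length (filter-accept (below? (suc P)) (s≤s (≤-reflexive Gx≡P))) ⟩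
      suc (length (filter (below? (suc P)) L))
        ≡⟨ cong suc (length-filter-<-suc P L) ⟩
      suc (classSize L P) + length (filter (below? P) L)
        ≡⟨ cong₂ _+_ (cong length (filter-accept (inClass? P) Gx≡P))
                     (cong length (filter-reject (below? P) (<-irrefl Gx≡P))) ⟨
      classSize (x ∷ L) P + length (filter (below? P) (x ∷ L))
        ∎
    ... | tri> _ Gx≢P Gx>P = begin
      length (filter (below? (suc P)) (x ∷ L))
        ≡⟨ cong length (filter-reject (below? (suc P)) (<⇒≱ Gx>P ∘′ s≤s⁻¹)) ⟩
      length (filter (below? (suc P)) L)
        ≡⟨ length-filter-<-suc P L ⟩
      classSize L P + length (filter (below? P) L)
        ≡⟨ cong₂ _+_ (cong length (filter-reject (inClass? P) Gx≢P))
                     (cong length (filter-reject (below? P) (<⇒≯ Gx>P))) ⟨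
      classSize (x ∷ L) P + length (filter (below? P) (x ∷ L))
        ∎

    sum-classSizes : ∀ P L → (∀ x → G x < P) → sum (applyDownFrom (classSize L) P) ≡ length L
    sum-classSizes P L G<P = trans (sum≡below P) (cong length (filter-all (below? P) (All.universal G<P L)))
      where
      sum≡below : ∀ P → sum (applyDownFrom (classSize L) P) ≡ length (filter (below? P) L)
      sum≡below zero    = sym (cong length (filter-none (below? 0) (All.universal (λ _ ()) L)))
      sum≡below (suc P) = trans (cong (classSize L P +_) (sum≡below P)) (sym (length-filter-<-suc P L))

    small-class : ∀ P .{{_ : NonZero P}} L → (∀ x → G x < P) → ∃[ c ] (c < P × P * classSize L c ≤ length L)
    small-class P L G<P with below-average P (classSize L)
    ... | c , c<P , avg = c , c<P , subst (P * classSize L c ≤_) (sum-classSizes P L G<P) avg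

  _≟ᶜ_ : ∀ {n} → DecidableEquality (Subcube n)
  _≟ᶜ_ = Vec.≡-dec (Maybe.≡-dec Bool._≟_)

  covering-upper-bound : ∀ {n d ℓ} rs → length rs ≡ suc ℓ → sum (map suc rs) ≤ suc d →
                         ∃[ S ] (IsCovering n d ℓ S × length S * #colours rs ≤ numSubcubes n ℓ)
  covering-upper-bound {n} {d} {ℓ} (p ∷ ps) len≡ sum≤
    with small-class (colourFrom p ps 0) (#colours (p ∷ ps)) {{#colours-nonZero (p ∷ ps)}}
                     (subcubes n ℓ) (colourFrom-< p ps 0)
  ... | c , c< , small = S , (deduplicate-! _≟ᶜ_ class , dims , covers) , size
    where
    class : List (Subcube n)
    class = filter (λ A → colourFrom p ps 0 A ≟ c) (subcubes n ℓ)
    S : List (Subcube n)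
    S = deduplicate _≟ᶜ_ class
    dims : All (λ A → dim A ≡ ℓ) S
    dims = All.tabulate λ A∈S →
      All.lookup (subcubes-dim n ℓ) (proj₁ (∈-filter⁻ _ (∈-deduplicate⁻ _≟ᶜ_ class A∈S)))
    covers : ∀ B → dim B ≡ d → Any (_⊑ B) S
    covers B dimB with window⇒attains B p ps (windows B p p ps (subst (_ ≤_) (sym dimB) (s≤s⁻¹ sum≤))) c c<
    ... | A , A⊆B , dimA , colourA =
      Any.map (λ { refl → ⊆ᶜ⇒⊑ A⊆B }) (∈-deduplicate⁺ _≟ᶜ_ (∈-filter⁺ _ A∈L colourA))
      where
      A∈L : A ∈ subcubes n ℓ
      A∈L = subst (λ k → A ∈ subcubes n k) (trans dimA (suc-injective len≡)) (∈-subcubes A)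
    size : length S * #colours (p ∷ ps) ≤ numSubcubes n ℓ
    size = begin
      length S * #colours (p ∷ ps)              ≤⟨ *-monoˡ-≤ _ (length-deduplicate _≟ᶜ_ class) ⟩
      length class * #colours (p ∷ ps)          ≡⟨ *-comm (length class) _ ⟩
      #colours (p ∷ ps) * length class          ≤⟨ small ⟩
      length (subcubes n ℓ)                     ≡⟨ length-subcubes n ℓ ⟩
      numSubcubes n ℓ                           ∎
      where open ≤-Reasoning

  sum-replicate : ∀ k x → sum (replicate k x) ≡ k * x
  sum-replicate zero    x = refl
  sum-replicate (suc k) x = cong (x +_) (sum-replicate k x)

  product-replicate : ∀ k x → product (replicate k x) ≡ x ^ k
  product-replicate zero    x = refl
  product-replicate (suc k) x = cong (x *_) (product-replicate k x)

  balanced-radices : ∀ k r a b .{{_ : NonZero a}} .{{_ : NonZero b}} → r ≤ k →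
    ∃[ rs ] (length rs ≡ k × sum (map suc rs) ≡ r * a + (k ∸ r) * b × #colours rs ≡ a ^ r * b ^ (k ∸ r))
  balanced-radices k r (suc a) (suc b) r≤k = replicate r a ++ replicate (k ∸ r) b , len , sum≡ , product≡
    where
    radices : map suc (replicate r a ++ replicate (k ∸ r) b) ≡ replicate r (suc a) ++ replicate (k ∸ r) (suc b)
    radices = trans (map-++ suc (replicate r a) _)
                    (cong₂ _++_ (map-replicate suc r a) (map-replicate suc (k ∸ r) b))
    len : length (replicate r a ++ replicate (k ∸ r) b) ≡ k
    len = trans (length-++ (replicate r a))
                (trans (cong₂ _+_ (length-replicate r) (length-replicate (k ∸ r))) (m+[n∸m]≡n r≤k))
    sum≡ : sum (map suc (replicate r a ++ replicate (k ∸ r) b)) ≡ r * suc a + (k ∸ r) * suc b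
    sum≡ = trans (cong sum radices) (trans (sum-++ (replicate r (suc a)) _)
                 (cong₂ _+_ (sum-replicate r (suc a)) (sum-replicate (k ∸ r) (suc b))))
    product≡ : #colours (replicate r a ++ replicate (k ∸ r) b) ≡ suc a ^ r * suc b ^ (k ∸ r)
    product≡ = trans (cong product radices) (trans (product-++ (replicate r (suc a)) _)
                     (cong₂ _*_ (product-replicate r (suc a)) (product-replicate (k ∸ r) (suc b))))

  rOf≤1+ℓ : ∀ d ℓ → rOf d ℓ ≤ suc ℓ
  rOf≤1+ℓ d ℓ = <⇒≤ (m%n<n (d ∸ ℓ) (suc ℓ))

  floorQ≤ceilQ : ∀ d ℓ → floorQ d ℓ ≤ ceilQ d ℓ
  floorQ≤ceilQ d ℓ = /-monoˡ-≤ (suc ℓ) (m≤m+n (suc d) ℓ)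

  ceilQ≤1+floorQ : ∀ d ℓ → ceilQ d ℓ ≤ suc (floorQ d ℓ)
  ceilQ≤1+floorQ d ℓ = begin
    (suc d + ℓ) / suc ℓ            ≤⟨ /-monoˡ-≤ (suc ℓ) (+-monoʳ-≤ (suc d) (n≤1+n ℓ)) ⟩
    (suc d + suc ℓ) / suc ℓ        ≡⟨ +-distrib-/-∣ʳ (suc d) {suc ℓ} {suc ℓ} ∣-refl ⟩
    floorQ d ℓ + suc ℓ / suc ℓ     ≡⟨ cong (floorQ d ℓ +_) (n/n≡1 (suc ℓ)) ⟩
    floorQ d ℓ + 1                 ≡⟨ +-comm (floorQ d ℓ) 1 ⟩
    suc (floorQ d ℓ)               ∎
    where open ≤-Reasoning

  module _ {d ℓ : ℕ} (ℓ<d : ℓ < d) where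

    floorQ-nonZero : NonZero (floorQ d ℓ)
    floorQ-nonZero = >-nonZero (m≥n⇒m/n>0 {suc d} {suc ℓ} (s≤s (<⇒≤ ℓ<d)))

    ceilQ-nonZero : NonZero (ceilQ d ℓ)
    ceilQ-nonZero = >-nonZero (<-≤-trans (>-nonZero⁻¹ _ {{floorQ-nonZero}}) (floorQ≤ceilQ d ℓ))

    rOf≡[1+d]%[1+ℓ] : rOf d ℓ ≡ suc d % suc ℓ
    rOf≡[1+d]%[1+ℓ] = sym (begin
      suc d % suc ℓ                  ≡⟨ cong (_% suc ℓ) 1+d≡[d∸ℓ]+[1+ℓ] ⟩
      (d ∸ ℓ + suc ℓ) % suc ℓ        ≡⟨ [m+n]%n≡m%n (d ∸ ℓ) (suc ℓ) ⟩
      rOf d ℓ                        ∎)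
      where
      open ≡-Reasoning
      1+d≡[d∸ℓ]+[1+ℓ] : suc d ≡ d ∸ ℓ + suc ℓ
      1+d≡[d∸ℓ]+[1+ℓ] = trans (cong suc (sym (m∸n+n≡m (<⇒≤ ℓ<d)))) (sym (+-suc (d ∸ ℓ) ℓ))

    balanced-sum≤1+d : rOf d ℓ * ceilQ d ℓ + (suc ℓ ∸ rOf d ℓ) * floorQ d ℓ ≤ suc d
    balanced-sum≤1+d = begin
      r * ceilQ d ℓ + (suc ℓ ∸ r) * b      ≤⟨ +-monoˡ-≤ _ (*-monoʳ-≤ r (ceilQ≤1+floorQ d ℓ)) ⟩
      r * suc b + (suc ℓ ∸ r) * b          ≡⟨ regroup r b (suc ℓ ∸ r) ⟩
      r + (r + (suc ℓ ∸ r)) * b            ≡⟨ cong (λ x → r + x * b) (m+[n∸m]≡n (rOf≤1+ℓ d ℓ)) ⟩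
      r + suc ℓ * b                        ≡⟨ cong₂ _+_ rOf≡[1+d]%[1+ℓ] (*-comm (suc ℓ) b) ⟩
      suc d % suc ℓ + b * suc ℓ            ≡⟨ m≡m%n+[m/n]*n (suc d) (suc ℓ) ⟨
      suc d                                ∎
      where
      open ≤-Reasoning
      r = rOf d ℓ
      b = floorQ d ℓ
      regroup : ∀ r b s → r * suc b + s * b ≡ r + (r + s) * b
      regroup = solve-∀

  toℚᵘ-[k/1]*[1/N] : ∀ k N → ℚ.toℚᵘ ((ℤ.+ k ℚ./ 1) ℚ.* (ℤ.+ 1 ℚ./ suc N)) ℚᵘ.≃ ℚᵘ.mkℚᵘ (ℤ.+ k) N
  toℚᵘ-[k/1]*[1/N] k N = ℚᵘ.≃-trans (ℚ.toℚᵘ-homo-* (ℤ.+ k ℚ./ 1) (ℤ.+ 1 ℚ./ suc N))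
    (ℚᵘ.≃-trans (ℚᵘ.*-cong (ℚ.toℚᵘ-fromℚᵘ (ℚᵘ.mkℚᵘ (ℤ.+ k) 0)) (ℚ.toℚᵘ-fromℚᵘ (ℚᵘ.mkℚᵘ (ℤ.+ 1) N)))
                (ℚᵘ.*≡* (cong₂ ℤ._*_ (ℤ.*-identityʳ (ℤ.+ k)) (cong (λ m → ℤ.+ suc m) (sym (+-identityʳ N))))))

  mkℚᵘ-≤ : ∀ a b c d → a * suc d ≤ c * suc b → ℚᵘ.mkℚᵘ (ℤ.+ a) b ℚᵘ.≤ ℚᵘ.mkℚᵘ (ℤ.+ c) d
  mkℚᵘ-≤ a b c d h = ℚᵘ.*≤* (subst₂ ℤ._≤_ (ℤ.pos-* a (suc d)) (ℤ.pos-* c (suc b)) (ℤ.+≤+ h))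

  [k/1]*recipℕ[N]≤recipℕ[P] : ∀ k {N P} .{{_ : NonZero N}} .{{_ : NonZero P}} →
                              k * P ≤ N → (ℤ.+ k ℚ./ 1) ℚ.* recipℕ N ℚ.≤ recipℕ P
  [k/1]*recipℕ[N]≤recipℕ[P] k {suc N} {suc P} kP≤N = ℚ.toℚᵘ-cancel-≤
    (ℚᵘ.≤-respˡ-≃ (ℚᵘ.≃-sym (toℚᵘ-[k/1]*[1/N] k N)) (ℚᵘ.≤-respʳ-≃ (ℚᵘ.≃-sym (ℚ.toℚᵘ-fromℚᵘ (ℚᵘ.mkℚᵘ (ℤ.+ 1) P)))
      (mkℚᵘ-≤ k N 1 P (subst (k * suc P ≤_) (sym (*-identityˡ (suc N))) kP≤N))))

  recipℕ[P]≤[k/1]*recipℕ[N] : ∀ k {N P} .{{_ : NonZero N}} .{{_ : NonZero P}} →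
                              N ≤ k * P → recipℕ P ℚ.≤ (ℤ.+ k ℚ./ 1) ℚ.* recipℕ N
  recipℕ[P]≤[k/1]*recipℕ[N] k {suc N} {suc P} N≤kP = ℚ.toℚᵘ-cancel-≤
    (ℚᵘ.≤-respʳ-≃ (ℚᵘ.≃-sym (toℚᵘ-[k/1]*[1/N] k N)) (ℚᵘ.≤-respˡ-≃ (ℚᵘ.≃-sym (ℚ.toℚᵘ-fromℚᵘ (ℚᵘ.mkℚᵘ (ℤ.+ 1) P)))
      (mkℚᵘ-≤ 1 P k N (subst (_≤ k * suc P) (sym (*-identityˡ (suc N))) N≤kP))))

  p≤q⇒p-r≤q : ∀ {p q r} → ℚ.0ℚ ℚ.< r → p ℚ.≤ q → p ℚ.- r ℚ.≤ q
  p≤q⇒p-r≤q {p} 0<r p≤q = ℚ.≤-trans (ℚ.≤-trans (ℚ.+-monoʳ-≤ p (ℚ.neg-antimono-≤ (ℚ.<⇒≤ 0<r)))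
                                                 (ℚ.≤-reflexive (ℚ.+-identityʳ p))) p≤q

  p≤q⇒p≤q+r : ∀ {p q r} → ℚ.0ℚ ℚ.< r → p ℚ.≤ q → p ℚ.≤ q ℚ.+ r
  p≤q⇒p≤q+r {q = q} 0<r p≤q = ℚ.≤-trans p≤q (ℚ.≤-trans (ℚ.≤-reflexive (sym (ℚ.+-identityʳ q)))
                                                        (ℚ.+-monoʳ-≤ q (ℚ.<⇒≤ 0<r)))

  numSubcubes-nonZero : ∀ {n ℓ} → ℓ ≤ n → NonZero (numSubcubes n ℓ)
  numSubcubes-nonZero {n} {ℓ} ℓ≤n = m*n≢0 _ _ {{m^n≢0 2 (n ∸ ℓ)}} {{>-nonZero (C-positive ℓ≤n)}}

  lowerBound≤cRatio : ∀ {n d ℓ S} → ℓ ≤ d → d ≤ n → IsCovering n d ℓ S →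
                      lowerBound d ℓ ℚ.≤ cRatio n ℓ (length S)
  lowerBound≤cRatio {S = S} ℓ≤d d≤n cover =
    recipℕ[P]≤[k/1]*recipℕ[N] (length S) {{numSubcubes-nonZero (≤-trans ℓ≤d d≤n)}} {{numSubcubes-nonZero ℓ≤d}}
                              (covering-lower-bound ℓ≤d d≤n cover)

  cRatio≤upperBound : ∀ {n d ℓ k} → ℓ < d → ℓ ≤ n → IsMinCover n d ℓ k → cRatio n ℓ k ℚ.≤ upperBound d ℓ
  cRatio≤upperBound {n} {d} {ℓ} {k} ℓ<d ℓ≤n (_ , minimal)
    with balanced-radices (suc ℓ) (rOf d ℓ) (ceilQ d ℓ) (floorQ d ℓ) {{ceilQ-nonZero ℓ<d}} {{floorQ-nonZero ℓ<d}}
                          (rOf≤1+ℓ d ℓ)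
  ... | rs , length-rs , sum-rs , #colours-rs
    with covering-upper-bound {n} {d} rs length-rs (≤-trans (≤-reflexive sum-rs) (balanced-sum≤1+d ℓ<d))
  ... | S , cover , small =
    [k/1]*recipℕ[N]≤recipℕ[P] k {{numSubcubes-nonZero ℓ≤n}} {{subst NonZero #colours-rs (#colours-nonZero rs)}}
    (begin
      k * (ceilQ d ℓ ^ rOf d ℓ * floorQ d ℓ ^ (suc ℓ ∸ rOf d ℓ))  ≡⟨ cong (k *_) #colours-rs ⟨
      k * #colours rs                                              ≤⟨ *-monoˡ-≤ (#colours rs) (minimal S cover) ⟩
      length S * #colours rs                                       ≤⟨ small ⟩
      numSubcubes n ℓ                                              ∎)
    where open ≤-Reasoning

open import Defs
open import Data.Nat using (ℕ; _<_; _≤_)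
open import Data.Product using (_×_; ∃-syntax)
open import Data.Rational using (ℚ; 0ℚ; _+_; _-_)
import Data.Rational as Q
open import Data.Nat.Properties using (<⇒≤; <-trans)
open import Data.Product using (_,_)
open import Relation.Binary.PropositionalEquality using (refl)
open CoveringBounds using (lowerBound≤cRatio; cRatio≤upperBound; p≤q⇒p-r≤q; p≤q⇒p≤q+r)

theorem2 : (d ℓ : ℕ) → 1 ≤ ℓ → ℓ < d →
    (ε : ℚ) → 0ℚ Q.< ε →
    ∃[ N ] ((n k : ℕ) → d < n → N ≤ n → IsMinCover n d ℓ k →
      (lowerBound d ℓ - ε) Q.≤ cRatio n ℓ k × cRatio n ℓ k Q.≤ (upperBound d ℓ + ε))
theorem2 d ℓ _ ℓ<d ε 0<ε = 0 , λ { n _ d<n _ minCover@((_ , cover , refl) , _) →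
    p≤q⇒p-r≤q 0<ε (lowerBound≤cRatio (<⇒≤ ℓ<d) (<⇒≤ d<n) cover)
  , p≤q⇒p≤q+r 0<ε (cRatio≤upperBound ℓ<d (<⇒≤ (<-trans ℓ<d d<n)) minCover) }
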